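{- Let $n\in\mathbb{N}$, let $\langle P,s\rangle$ be a configuration, $h$ a history and $\mathcal{S}$ a probabilistic scheduler. Then: (Determinism) if $h\langle P,s\rangle\Downarrow^{\mathcal{S},n}\mu$ and $h\langle P,s\rangle\Downarrow^{\mathcal{S},n}\nu$ then $\mu=\nu$; (Monotonicity) if $h\langle P,s\rangle\Downarrow^{\mathcal{S},n}\mu$ and $h\langle P,s\rangle\Downarrow^{\mathcal{S},n+1}\nu$ then $\mu\le\nu$.
   Context: Fix a set $S$ of states, a set of atomic programs $\mathtt{a}$ and a set of conditions $\mathtt{b}$. Programs are given by the grammar $P ::= \mathtt{skip} \mid \mathtt{a} \mid P;P \mid P\parallel P \mid P +_{\mathtt{p}} P \mid P + P \mid \mathtt{if}\ \mathtt{b}\ \mathtt{then}\ P\ \mathtt{else}\ P \mid \mathtt{while}\ \mathtt{b}\ P$, with $\mathtt{p}\in[0,1]\cap\mathbb{Q}$; $\mathrm{Pr}$ is the set of programs. For a set $Y$, $\mathcal{V}_{=1,\omega}(Y)$ (resp. $\mathcal{V}_{\le1,\omega}(Y)$) denotes finitely supported probability (resp. subprobability) distributions on $Y$, written $\sum_i r_i\cdot y_i$; they are ordered pointwise ($\mu\le\nu$ iff $\mu(U)\le\nu(U)$ for all $U\subseteq Y$), and $\bot$ is the zero distribution. Each atomic program has $[\![\mathtt{a}]\!]:S\to\mathcal{V}_{=1,\omega}(S)$ and each condition $[\![\mathtt{b}]\!]:S\to\{\mathtt{tt},\mathtt{ff}\}$. Elements of $\mathcal{V}_{=1,\omega}(S+\mathrm{Pr}\times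 S)$ are written $\sum_i p_i\cdot\langle P_i,s_i\rangle+\sum_j p_j\cdot s_j$. The small-step relation $\longrightarrow\subseteq(\mathrm{Pr}\times S)\times\mathcal{V}_{=1,\omega}(S+\mathrm{Pr}\times S)$ is the least relation closed under: $\langle\mathtt{a},s\rangle\longrightarrow[\![\mathtt{a}]\!](s)$; $\langle\mathtt{skip},s\rangle\longrightarrow1\cdot s$; if $\langle P,s\rangle\longrightarrow\sum_ip_i\cdot\langle P_i,s_i\rangle+\sum_jp_j\cdot s_j$ then $\langle P;Q,s\rangle\longrightarrow\sum_ip_i\cdot\langle P_i;Q,s_i\rangle+\sum_jp_j\cdot\langle Q,s_j\rangle$ and $\langle P\parallel Q,s\rangle\longrightarrow\sum_ip_i\cdot\langle P_i\parallel Q,s_i\rangle+\sum_jp_j\cdot\langle Q,s_j\rangle$; if $\langle Q,s\rangle\longrightarrow\sum_ip_i\cdot\langle Q_i,s_i\rangle+\sum_jp_j\cdot s_j$ then $\langle P\parallel Q,s\rangle\longrightarrow\sum_ip_i\cdot\langle P\parallel Q_i,s_i\rangle+\sum_jp_j\cdot\langle P,s_j\rangle$; if $\langle P,s\rangle\longrightarrow\mu$ and $\langle Q,s\rangle\longrightarrow\nu$ then $\langle P+_{\mathtt{p}}Q,s\rangle\longrightarrow\mathtt{p}\cdot\mu+(1-\mathtt{p})\cdot\nu$; if $\langle P,s\rangle\longrightarrow\mu$ or $\langle Q,s\rangle\longrightarrow\mu$ then $\langle P+Q,s\rangle\longrightarrow\mu$; $\langle\mathtt{if}\ \mathtt{b}\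 \mathtt{then}\ P\ \mathtt{else}\ Q,s\rangle\longrightarrow1\cdot\langle P,s\rangle$ if $[\![\mathtt{b}]\!](s)=\mathtt{tt}$, $\longrightarrow1\cdot\langle Q,s\rangle$ if $\mathtt{ff}$; $\langle\mathtt{while}\ \mathtt{b}\ P,s\rangle\longrightarrow1\cdot\langle P;\mathtt{while}\ \mathtt{b}\ P,s\rangle$ if $[\![\mathtt{b}]\!](s)=\mathtt{tt}$, $\longrightarrow1\cdot s$ if $\mathtt{ff}$. A history is a finite list of pairs (configuration, element of $\mathcal{V}_{=1,\omega}(S+\mathrm{Pr}\times S)$); $h\langle P,s\rangle$ denotes the pair $(h,\langle P,s\rangle)$, and $h\langle P,s\rangle\nu\langle P',s'\rangle$ denotes the history $h$ extended with $(\langle P,s\rangle,\nu)$ paired with the configuration $\langle P',s'\rangle$. A probabilistic scheduler $\mathcal{S}$ is a partial function from such pairs $h\langle P,s\rangle$ to $\mathcal{V}_{=1,\omega}(S+\mathrm{Pr}\times S)$ such that whenever $\mathcal{S}(h\langle P,s\rangle)$ is defined it is a convex combination $\sum_kp_k\cdot\nu_k$ of elements $\nu_k$ of the set $\{\nu\mid\langle P,s\rangle\longrightarrow\nu\}$. The big-step relation $h\langle P,s\rangle\Downarrow^{\mathcal{S},n}\mu$ ($n\in\mathbb{N}$, $\mu\in\mathcal{V}_{\le1,\omega}(S)$) is defined inductively by: $h\langle P,s\rangle\Downarrow^{\mathcal{S},0}\bot$; and $h\langle P,s\rangle\Downarrow^{\mathcal{S},n+1}\sum_kp_k\cdot(\sum_ip_{k,i}\cdot\mu_{k,i}+\sum_jp_{k,j}\cdot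 s_{k,j})$ whenever $\mathcal{S}(h\langle P,s\rangle)=\sum_kp_k\cdot\nu_k$ with $\nu_k=\sum_ip_{k,i}\cdot\langle P_{k,i},s_{k,i}\rangle+\sum_jp_{k,j}\cdot s_{k,j}$ and for all $k,i$, $h\langle P,s\rangle\nu_k\langle P_{k,i},s_{k,i}\rangle\Downarrow^{\mathcal{S},n}\mu_{k,i}$. -}

module Defs where

open import Data.Bool using (Bool; true; false)
open import Data.Nat using (ℕ; zero; suc)
open import Data.Rational using (ℚ; 0ℚ; 1ℚ; _+_; _*_; _-_; _≤_)
open import Data.List using (List; []; _∷_; _++_; [_]; map)
open import Data.List.Relation.Unary.All using (All)
open import Data.Product using (_×_; _,_; Σ; proj₁; proj₂)
open import Data.Sum using (_⊎_; inj₁; inj₂)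
open import Data.Maybe using (Maybe; just)
open import Relation.Binary.PropositionalEquality using (_≡_)

-- Finitely supported (sub)distributions, as formal sums  Σ_i r_i · y_i
-- represented by lists of (weight , point).  Two lists denote the same
-- distribution when they give the same mass to every subset.

Dist : Set → Set
Dist Y = List (ℚ × Y)

weight : ∀ {Y} → Dist Y → ℚ
weight [] = 0ℚ
weight ((r , _) ∷ μ) = r + weight μ

mass : ∀ {Y} → (Y → Bool) → Dist Y → ℚ
mass U [] = 0ℚ
mass U ((r , y) ∷ μ) with U y
... | true  = r + mass U μ
... | false = mass U μ

⊥D : ∀ {Y} → Dist Y
⊥D = []

scale : ∀ {Y} → ℚ → Dist Y → Dist Y
scale r = map (λ { (q , y) → (r * q , y) })

_≤D_ : ∀ {Y} → Dist Y → Dist Y → Set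
μ ≤D ν = ∀ U → mass U μ ≤ mass U ν

_≈D_ : ∀ {Y} → Dist Y → Dist Y → Set
μ ≈D ν = ∀ U → mass U μ ≡ mass U ν

IsProb : ∀ {Y} → Dist Y → Set
IsProb μ = All (λ e → 0ℚ ≤ proj₁ e) μ × weight μ ≡ 1ℚ

record Language : Set₁ where
  field
    State   : Set
    Atom    : Set
    Cond    : Set
    ⟦_⟧a    : Atom → State → Dist State
    ⟦_⟧a-prob : ∀ a s → IsProb (⟦ a ⟧a s)
    ⟦_⟧b    : Cond → State → Bool

module Lang (L : Language) where
  open Language L public

  infixr 7 _⨾_
  infixr 6 _∥_
  infixr 6 _⊕_
  data Pr : Set where
    skip   : Pr
    atom   : Atom → Pr
    _⨾_    : Pr → Pr → Pr
    _∥_    : Pr → Pr → Pr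
    pch    : Pr → (p : ℚ) → 0ℚ ≤ p → p ≤ 1ℚ → Pr → Pr
    _⊕_    : Pr → Pr → Pr
    if_then_else_ : Cond → Pr → Pr → Pr
    while  : Cond → Pr → Pr

  Config : Set
  Config = Pr × State

  Res : Set
  Res = State ⊎ Config

  private
    seqK : Pr → Res → Res
    seqK Q (inj₁ s')       = inj₂ (Q , s')
    seqK Q (inj₂ (P' , s')) = inj₂ (P' ⨾ Q , s')

    parLK : Pr → Res → Res
    parLK Q (inj₁ s')       = inj₂ (Q , s')
    parLK Q (inj₂ (P' , s')) = inj₂ (P' ∥ Q , s')

    parRK : Pr → Res → Res
    parRK P (inj₁ s')       = inj₂ (P , s')
    parRK P (inj₂ (Q' , s')) = inj₂ (P ∥ Q' , s')

  mapD : ∀ {X Y : Set} → (X → Y) → Dist X → Dist Y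
  mapD f = map (λ { (r , x) → (r , f x) })

  infix 3 _⟶_
  data _⟶_ : Config → Dist Res → Set where
    ⟶atom  : ∀ {a s} → (atom a , s) ⟶ mapD inj₁ (⟦ a ⟧a s)
    ⟶skip  : ∀ {s} → (skip , s) ⟶ [ (1ℚ , inj₁ s) ]
    ⟶seq   : ∀ {P Q s ν} → (P , s) ⟶ ν → (P ⨾ Q , s) ⟶ mapD (seqK Q) ν
    ⟶parL  : ∀ {P Q s ν} → (P , s) ⟶ ν → (P ∥ Q , s) ⟶ mapD (parLK Q) ν
    ⟶parR  : ∀ {P Q s ν} → (Q , s) ⟶ ν → (P ∥ Q , s) ⟶ mapD (parRK P) ν
    ⟶pch   : ∀ {P Q s μ ν p} {0≤p : 0ℚ ≤ p} {p≤1 : p ≤ 1ℚ} →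
             (P , s) ⟶ μ → (Q , s) ⟶ ν →
             (pch P p 0≤p p≤1 Q , s) ⟶ scale p μ ++ scale (1ℚ - p) ν
    ⟶ndL   : ∀ {P Q s μ} → (P , s) ⟶ μ → (P ⊕ Q , s) ⟶ μ
    ⟶ndR   : ∀ {P Q s μ} → (Q , s) ⟶ μ → (P ⊕ Q , s) ⟶ μ
    ⟶ifT   : ∀ {b P Q s} → ⟦ b ⟧b s ≡ true →
             (if b then P else Q , s) ⟶ [ (1ℚ , inj₂ (P , s)) ]
    ⟶ifF   : ∀ {b P Q s} → ⟦ b ⟧b s ≡ false →
             (if b then P else Q , s) ⟶ [ (1ℚ , inj₂ (Q , s)) ]
    ⟶whT   : ∀ {b P s} → ⟦ b ⟧b s ≡ true →
             (while b P , s) ⟶ [ (1ℚ , inj₂ (P ⨾ while b P , s)) ]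
    ⟶whF   : ∀ {b P s} → ⟦ b ⟧b s ≡ false →
             (while b P , s) ⟶ [ (1ℚ , inj₁ s) ]

  -- histories: finite lists of (configuration , transition distribution),
  -- oldest entry first
  History : Set
  History = List (Config × Dist Res)

  ConvexComb : Config → List (ℚ × Dist Res) → Set
  ConvexComb c d = IsProb d × All (λ e → c ⟶ proj₂ e) d

  record Scheduler : Set where
    field
      sched : History → Config → Maybe (List (ℚ × Dist Res))
      valid : ∀ h c d → sched h c ≡ just d → ConvexComb c d
  open Scheduler public

  module _ (𝒮 : Scheduler) where
    mutual
      data Big : History → Config → ℕ → Dist State → Set where
        big0 : ∀ {h c} → Big h c zero ⊥D
        bigS : ∀ {h c n d μ} → sched 𝒮 h c ≡ just d →
               BigK h c n d μ → Big h c (suc n) μ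

      BigK : History → Config → ℕ → List (ℚ × Dist Res) → Dist State → Set
      BigK h c n [] μ = μ ≡ ⊥D
      BigK h c n ((p , ν) ∷ d) μ = Σ (Dist State) λ μν → Σ (Dist State) λ μd →
        BigNu h c n ν ν μν × BigK h c n d μd × μ ≡ scale p μν ++ μd

      -- Σ_i p_i · μ_i + Σ_j p_j · s_j, where ν is the full transition
      -- (recorded in the history) and the list argument is the part of ν
      -- still to be processed
      data BigNu (h : History) (c : Config) (n : ℕ) (ν : Dist Res) :
                 Dist Res → Dist State → Set where
        nuNil  : BigNu h c n ν [] ⊥D
        nuTerm : ∀ {p s' ρ μ} → BigNu h c n ν ρ μ →
                 BigNu h c n ν ((p , inj₁ s') ∷ ρ) ((p , s') ∷ μ)
        nuCont : ∀ {p c' ρ μ₁ μ} →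
                 Big (h ++ [ (c , ν) ]) c' n μ₁ → BigNu h c n ν ρ μ →
                 BigNu h c n ν ((p , inj₂ c') ∷ ρ) (scale p μ₁ ++ μ)

{-# OPTIONS --safe #-}
-- A scheduler is a function of the history, so two
-- derivations from h⟨P,s⟩ unfold the same convex combination Σₖ pₖ · νₖ
-- and differ only in the recursive results; determinism is then
-- congruence.  For monotonicity the base case is ⊥ ≤ ν, which holds
-- because every derived distribution has nonnegative weights (those of
-- the scheduler's combinations and of the transitions are), and the
-- inductive step uses that μ ↦ p · μ ++ ν is monotone for p ≥ 0.
module Submission where

open import Defs
open import Data.Nat using (ℕ; suc)
open import Data.Product using (_×_; _,_; proj₁; proj₂)
open import Data.Bool using (true; false)
open import Data.List using (List; []; _∷_; _++_)
open import Data.List.Relation.Unary.All using (All; []; _∷_) renaming (map to All-map)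
open import Data.List.Relation.Unary.All.Properties using (++⁺; map⁺)
open import Data.Maybe using (just)
open import Data.Maybe.Properties using (just-injective)
open import Data.Rational using (ℚ; 0ℚ; 1ℚ; _+_; _*_; _-_; _≤_; -_; nonNegative)
open import Data.Rational.Properties
  using (≤-refl; ≤-trans; ≤-reflexive; +-mono-≤; +-monoˡ-≤; *-monoˡ-≤-nonNeg; *-zeroʳ; +-identityˡ;
         +-assoc; *-distribˡ-+; +-inverseʳ; nonNegative⁻¹; nonNeg+nonNeg⇒nonNeg; nonNeg*nonNeg⇒nonNeg)
open import Function using (_∘_)
open import Relation.Binary.PropositionalEquality using (_≡_; refl; sym; trans; cong; cong₂)

p≤1⇒0≤1-p : ∀ {p} → p ≤ 1ℚ → 0ℚ ≤ 1ℚ - p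
p≤1⇒0≤1-p {p} p≤1 = ≤-trans (≤-reflexive (sym (+-inverseʳ p))) (+-monoˡ-≤ (- p) p≤1)

0≤p+q : ∀ {p q} → 0ℚ ≤ p → 0ℚ ≤ q → 0ℚ ≤ p + q
0≤p+q {p} {q} 0≤p 0≤q =
  nonNegative⁻¹ (p + q) {{nonNeg+nonNeg⇒nonNeg p {{nonNegative 0≤p}} q {{nonNegative 0≤q}}}}

0≤p*q : ∀ {p q} → 0ℚ ≤ p → 0ℚ ≤ q → 0ℚ ≤ p * q
0≤p*q {p} {q} 0≤p 0≤q =
  nonNegative⁻¹ (p * q) {{nonNeg*nonNeg⇒nonNeg p {{nonNegative 0≤p}} q {{nonNegative 0≤q}}}}

module _ {Y : Set} where

  NonNegDist : Dist Y → Set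
  NonNegDist = All (λ e → 0ℚ ≤ proj₁ e)

  mass-++ : ∀ U (μ ν : Dist Y) → mass U (μ ++ ν) ≡ mass U μ + mass U ν
  mass-++ U [] ν = sym (+-identityˡ _)
  mass-++ U ((r , y) ∷ μ) ν with U y
  ... | true  = trans (cong (r +_) (mass-++ U μ ν)) (sym (+-assoc r _ _))
  ... | false = mass-++ U μ ν

  mass-scale : ∀ U p (μ : Dist Y) → mass U (scale p μ) ≡ p * mass U μ
  mass-scale U p [] = sym (*-zeroʳ p)
  mass-scale U p ((r , y) ∷ μ) with U y
  ... | true  = trans (cong (p * r +_) (mass-scale U p μ)) (sym (*-distribˡ-+ p r _))
  ... | false = mass-scale U p μ

  mass-nonNeg : ∀ U {μ : Dist Y} → NonNegDist μ → 0ℚ ≤ mass U μ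
  mass-nonNeg U [] = ≤-refl
  mass-nonNeg U {(_ , y) ∷ _} (0≤r ∷ μ≥0) with U y
  ... | true  = 0≤p+q 0≤r (mass-nonNeg U μ≥0)
  ... | false = mass-nonNeg U μ≥0

  scale-nonNeg : ∀ {p} {μ : Dist Y} → 0ℚ ≤ p → NonNegDist μ → NonNegDist (scale p μ)
  scale-nonNeg 0≤p μ≥0 = map⁺ (All-map (0≤p*q 0≤p) μ≥0)

  ⊥D-least : {μ : Dist Y} → NonNegDist μ → ⊥D ≤D μ
  ⊥D-least μ≥0 U = mass-nonNeg U μ≥0

  ≤D-refl : (μ : Dist Y) → μ ≤D μ
  ≤D-refl μ U = ≤-refl

  ∷-monoʳ-≤D : ∀ e {μ ν : Dist Y} → μ ≤D ν → (e ∷ μ) ≤D (e ∷ ν)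
  ∷-monoʳ-≤D (r , y) μ≤ν U with U y
  ... | true  = +-mono-≤ (≤-refl {r}) (μ≤ν U)
  ... | false = μ≤ν U

  scale-++-mono-≤D : ∀ {p} {μ μ′ ν ν′ : Dist Y} → 0ℚ ≤ p → μ ≤D μ′ → ν ≤D ν′ →
                     (scale p μ ++ ν) ≤D (scale p μ′ ++ ν′)
  scale-++-mono-≤D {p} {μ} {μ′} {ν} {ν′} 0≤p μ≤μ′ ν≤ν′ U
    rewrite mass-++ U (scale p μ) ν | mass-++ U (scale p μ′) ν′
          | mass-scale U p μ | mass-scale U p μ′ =
    +-mono-≤ (*-monoˡ-≤-nonNeg p {{nonNegative 0≤p}} (μ≤μ′ U)) (ν≤ν′ U)

module BigStep (L : Language) where
  open Lang L

  ⟶-nonNeg : ∀ {c ν} → c ⟶ ν → NonNegDist ν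
  ⟶-nonNeg (⟶atom {a} {s}) = map⁺ (proj₁ (⟦ a ⟧a-prob s))
  ⟶-nonNeg ⟶skip = nonNegative⁻¹ 1ℚ ∷ []
  ⟶-nonNeg (⟶seq t) = map⁺ (⟶-nonNeg t)
  ⟶-nonNeg (⟶parL t) = map⁺ (⟶-nonNeg t)
  ⟶-nonNeg (⟶parR t) = map⁺ (⟶-nonNeg t)
  ⟶-nonNeg (⟶pch {0≤p = 0≤p} {p≤1 = p≤1} t u) =
    ++⁺ (scale-nonNeg 0≤p (⟶-nonNeg t)) (scale-nonNeg (p≤1⇒0≤1-p p≤1) (⟶-nonNeg u))
  ⟶-nonNeg (⟶ndL t) = ⟶-nonNeg t
  ⟶-nonNeg (⟶ndR t) = ⟶-nonNeg t
  ⟶-nonNeg (⟶ifT _) = nonNegative⁻¹ 1ℚ ∷ []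
  ⟶-nonNeg (⟶ifF _) = nonNegative⁻¹ 1ℚ ∷ []
  ⟶-nonNeg (⟶whT _) = nonNegative⁻¹ 1ℚ ∷ []
  ⟶-nonNeg (⟶whF _) = nonNegative⁻¹ 1ℚ ∷ []

  NonNegCombination : List (ℚ × Dist Res) → Set
  NonNegCombination d = NonNegDist d × All (NonNegDist ∘ proj₂) d

  convexComb-nonNeg : ∀ {c d} → ConvexComb c d → NonNegCombination d
  convexComb-nonNeg ((d≥0 , _) , steps) = d≥0 , All-map ⟶-nonNeg steps

  module _ (𝒮 : Scheduler) where

    scheduled-nonNeg : ∀ {h c d} → sched 𝒮 h c ≡ just d → NonNegCombination d
    scheduled-nonNeg {h} {c} {d} eq = convexComb-nonNeg (valid 𝒮 h c d eq)

    mutual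
      Big-deterministic : ∀ {h c n μ ν} → Big 𝒮 h c n μ → Big 𝒮 h c n ν → μ ≡ ν
      Big-deterministic big0 big0 = refl
      Big-deterministic (bigS {d = d} eq k) (bigS eq′ k′) with just-injective (trans (sym eq) eq′)
      ... | refl = BigK-deterministic d k k′

      BigK-deterministic : ∀ {h c n} d {μ ν} → BigK 𝒮 h c n d μ → BigK 𝒮 h c n d ν → μ ≡ ν
      BigK-deterministic [] refl refl = refl
      BigK-deterministic ((p , _) ∷ d) (_ , _ , x , y , refl) (_ , _ , x′ , y′ , refl) =
        cong₂ (λ μν μd → scale p μν ++ μd) (BigNu-deterministic x x′) (BigK-deterministic d y y′)

      BigNu-deterministic : ∀ {h c n ν ρ μ μ′} → BigNu 𝒮 h c n ν ρ μ → BigNu 𝒮 h c n ν ρ μ′ → μ ≡ μ′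
      BigNu-deterministic nuNil nuNil = refl
      BigNu-deterministic (nuTerm {p = p} {s' = s′} x) (nuTerm y) =
        cong ((p , s′) ∷_) (BigNu-deterministic x y)
      BigNu-deterministic (nuCont {p = p} b x) (nuCont b′ y) =
        cong₂ (λ μ₁ μ → scale p μ₁ ++ μ) (Big-deterministic b b′) (BigNu-deterministic x y)

    mutual
      Big-nonNeg : ∀ {h c n μ} → Big 𝒮 h c n μ → NonNegDist μ
      Big-nonNeg big0 = []
      Big-nonNeg (bigS {d = d} eq k) = BigK-nonNeg d (scheduled-nonNeg eq) k

      BigK-nonNeg : ∀ {h c n} d {μ} → NonNegCombination d → BigK 𝒮 h c n d μ → NonNegDist μ
      BigK-nonNeg [] _ refl = []
      BigK-nonNeg (_ ∷ d) (0≤p ∷ d≥0 , ν≥0 ∷ νs≥0) (_ , _ , x , y , refl) =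
        ++⁺ (scale-nonNeg 0≤p (BigNu-nonNeg ν≥0 x)) (BigK-nonNeg d (d≥0 , νs≥0) y)

      BigNu-nonNeg : ∀ {h c n ν ρ μ} → NonNegDist ρ → BigNu 𝒮 h c n ν ρ μ → NonNegDist μ
      BigNu-nonNeg _ nuNil = []
      BigNu-nonNeg (0≤p ∷ ρ≥0) (nuTerm x) = 0≤p ∷ BigNu-nonNeg ρ≥0 x
      BigNu-nonNeg (0≤p ∷ ρ≥0) (nuCont b x) = ++⁺ (scale-nonNeg 0≤p (Big-nonNeg b)) (BigNu-nonNeg ρ≥0 x)

    mutual
      Big-mono : ∀ {h c n μ ν} → Big 𝒮 h c n μ → Big 𝒮 h c (suc n) ν → μ ≤D ν
      Big-mono big0 b = ⊥D-least (Big-nonNeg b)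
      Big-mono (bigS {d = d} eq k) (bigS eq′ k′) with just-injective (trans (sym eq) eq′)
      ... | refl = BigK-mono d (scheduled-nonNeg eq) k k′

      BigK-mono : ∀ {h c n} d {μ ν} → NonNegCombination d →
                  BigK 𝒮 h c n d μ → BigK 𝒮 h c (suc n) d ν → μ ≤D ν
      BigK-mono [] _ refl refl = ≤D-refl ⊥D
      BigK-mono (_ ∷ d) (0≤p ∷ d≥0 , ν≥0 ∷ νs≥0) (μν , μd , x , y , refl) (μν′ , μd′ , x′ , y′ , refl) =
        scale-++-mono-≤D {μ = μν} {μν′} {μd} {μd′} 0≤p (BigNu-mono ν≥0 x x′) (BigK-mono d (d≥0 , νs≥0) y y′)

      BigNu-mono : ∀ {h c n ν ρ μ μ′} → NonNegDist ρ →
                   BigNu 𝒮 h c n ν ρ μ → BigNu 𝒮 h c (suc n) ν ρ μ′ → μ ≤D μ′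
      BigNu-mono _ nuNil nuNil = ≤D-refl ⊥D
      BigNu-mono (_ ∷ ρ≥0) (nuTerm {p = p} {s' = s′} x) (nuTerm y) =
        ∷-monoʳ-≤D (p , s′) (BigNu-mono ρ≥0 x y)
      BigNu-mono (0≤p ∷ ρ≥0) (nuCont {μ₁ = μ₁} {μ = μ} b x) (nuCont {μ₁ = μ₁′} {μ = μ′} b′ y) =
        scale-++-mono-≤D {μ = μ₁} {μ₁′} {μ} {μ′} 0≤p (Big-mono b b′) (BigNu-mono ρ≥0 x y)

theorem3p3 : (L : Language) → let open Lang L in
    (n : ℕ) (P : Pr) (s : State) (h : History) (𝒮 : Scheduler) →
      (∀ {μ ν} → Big 𝒮 h (P , s) n μ → Big 𝒮 h (P , s) n ν → μ ≈D ν)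
      × (∀ {μ ν} → Big 𝒮 h (P , s) n μ → Big 𝒮 h (P , s) (suc n) ν → μ ≤D ν)
theorem3p3 L n P s h 𝒮 =
  (λ b b′ U → cong (mass U) (Big-deterministic 𝒮 b b′)) , Big-mono 𝒮
  where open BigStep L
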